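{- Let $\mathcal X$ be as defined below, let $h\in\mathbb Z[u_0,\dots,u_5]$ be a primitive linear form and $\mathcal U_h=\mathcal X\setminus(\{h=0\}\cap\mathcal X)$. Then $\mathcal U_h$ is everywhere locally soluble (i.e. $\mathcal U_h(\mathbb R)\neq\emptyset$ and $\mathcal U_h(\mathbb Z_\ell)\neq\emptyset$ for all primes $\ell$) precisely when $h\not\equiv u_2+u_5\pmod 2$.
   Context: $\mathcal X\subseteq\mathbb P^5_{\mathbb Z}$ (coordinates $u_0,\dots,u_5$) is defined by the five quadratic forms $u_0u_3+22u_0u_4+121u_0u_5-u_1^2-121u_1u_3+2662u_1u_4-36355u_2u_4-9306u_2u_5+10494u_3u_4-242u_3u_5-215501u_4^2+68123u_4u_5-13794u_5^2$, $u_0u_4+11u_0u_5-u_1u_2-11u_1u_3+242u_1u_4-3223u_2u_4-847u_2u_5+902u_3u_4-11u_3u_5-19272u_4^2+6413u_4u_5-1331u_5^2$, $u_0u_5-u_1u_3+22u_1u_4-u_2^2-286u_2u_4-77u_2u_5+77u_3u_4-1694u_4^2+572u_4u_5-121u_5^2$, $u_1u_4-u_2u_3-11u_2u_4-77u_4^2+55u_4u_5-11u_5^2$, $u_1u_5-u_2u_4-11u_2u_5-u_3^2+11u_3u_4-44u_4^2$. -}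

module Defs where

open import Data.Nat as ℕ using (ℕ; suc; _≥_)
open import Data.Nat.Primality using (Prime)
open import Data.Integer as ℤ using (ℤ; +_; -[1+_]; -_)
open import Data.Integer.Divisibility as ℤD using ()
open import Data.Rational as ℚ using (ℚ)
open import Data.Fin using (Fin; zero; suc)
open import Data.List using (List; []; _∷_)
open import Data.Product using (_×_; _,_; Σ-syntax)
open import Relation.Nullary using (¬_)
open import Relation.Binary.PropositionalEquality using (_≡_)

-- A term  c * u_i * u_j  of a quadratic form.
record QTerm : Set where
  constructor _·u_u_
  field
    coeff : ℤ
    i j   : Fin 6

u₀ u₁ u₂ u₃ u₄ u₅ : Fin 6
u₀ = zero
u₁ = suc zero
u₂ = suc (suc zero)
u₃ = suc (suc (suc zero))
u₄ = suc (suc (suc (suc zero)))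
u₅ = suc (suc (suc (suc (suc zero))))

n : ℕ → ℤ
n k = - (+ k)
p : ℕ → ℤ
p k = + k

-- The five quadratic forms defining 𝒳 ⊆ ℙ⁵_ℤ.
F₁ F₂ F₃ F₄ F₅ : List QTerm
F₁ = (p 1 ·u u₀ u u₃) ∷ (p 22 ·u u₀ u u₄) ∷ (p 121 ·u u₀ u u₅) ∷ (n 1 ·u u₁ u u₁)
   ∷ (n 121 ·u u₁ u u₃) ∷ (p 2662 ·u u₁ u u₄) ∷ (n 36355 ·u u₂ u u₄) ∷ (n 9306 ·u u₂ u u₅)
   ∷ (p 10494 ·u u₃ u u₄) ∷ (n 242 ·u u₃ u u₅) ∷ (n 215501 ·u u₄ u u₄) ∷ (p 68123 ·u u₄ u u₅)
   ∷ (n 13794 ·u u₅ u u₅) ∷ []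
F₂ = (p 1 ·u u₀ u u₄) ∷ (p 11 ·u u₀ u u₅) ∷ (n 1 ·u u₁ u u₂) ∷ (n 11 ·u u₁ u u₃)
   ∷ (p 242 ·u u₁ u u₄) ∷ (n 3223 ·u u₂ u u₄) ∷ (n 847 ·u u₂ u u₅) ∷ (p 902 ·u u₃ u u₄)
   ∷ (n 11 ·u u₃ u u₅) ∷ (n 19272 ·u u₄ u u₄) ∷ (p 6413 ·u u₄ u u₅) ∷ (n 1331 ·u u₅ u u₅) ∷ []
F₃ = (p 1 ·u u₀ u u₅) ∷ (n 1 ·u u₁ u u₃) ∷ (p 22 ·u u₁ u u₄) ∷ (n 1 ·u u₂ u u₂)
   ∷ (n 286 ·u u₂ u u₄) ∷ (n 77 ·u u₂ u u₅) ∷ (p 77 ·u u₃ u u₄) ∷ (n 1694 ·u u₄ u u₄)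
   ∷ (p 572 ·u u₄ u u₅) ∷ (n 121 ·u u₅ u u₅) ∷ []
F₄ = (p 1 ·u u₁ u u₄) ∷ (n 1 ·u u₂ u u₃) ∷ (n 11 ·u u₂ u u₄) ∷ (n 77 ·u u₄ u u₄)
   ∷ (p 55 ·u u₄ u u₅) ∷ (n 11 ·u u₅ u u₅) ∷ []
F₅ = (p 1 ·u u₁ u u₅) ∷ (n 1 ·u u₂ u u₄) ∷ (n 11 ·u u₂ u u₅) ∷ (n 1 ·u u₃ u u₃)
   ∷ (p 11 ·u u₃ u u₄) ∷ (n 44 ·u u₄ u u₄) ∷ []

equations : Fin 5 → List QTerm
equations zero = F₁
equations (suc zero) = F₂
equations (suc (suc zero)) = F₃
equations (suc (suc (suc zero))) = F₄
equations (suc (suc (suc (suc zero)))) = F₅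

evalℤ : List QTerm → (Fin 6 → ℤ) → ℤ
evalℤ [] x = + 0
evalℤ ((c ·u i u j) ∷ ts) x = c ℤ.* x i ℤ.* x j ℤ.+ evalℤ ts x

evalℚ : List QTerm → (Fin 6 → ℚ) → ℚ
evalℚ [] x = ℚ.0ℚ
evalℚ ((c ·u i u j) ∷ ts) x = (c ℚ./ 1) ℚ.* x i ℚ.* x j ℚ.+ evalℚ ts x

LinForm : Set
LinForm = Fin 6 → ℤ

linℤ : LinForm → (Fin 6 → ℤ) → ℤ
linℤ c x = c u₀ ℤ.* x u₀ ℤ.+ c u₁ ℤ.* x u₁ ℤ.+ c u₂ ℤ.* x u₂
         ℤ.+ c u₃ ℤ.* x u₃ ℤ.+ c u₄ ℤ.* x u₄ ℤ.+ c u₅ ℤ.* x u₅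

linℚ : LinForm → (Fin 6 → ℚ) → ℚ
linℚ c x = (c u₀ ℚ./ 1) ℚ.* x u₀ ℚ.+ (c u₁ ℚ./ 1) ℚ.* x u₁ ℚ.+ (c u₂ ℚ./ 1) ℚ.* x u₂
         ℚ.+ (c u₃ ℚ./ 1) ℚ.* x u₃ ℚ.+ (c u₄ ℚ./ 1) ℚ.* x u₄ ℚ.+ (c u₅ ℚ./ 1) ℚ.* x u₅

Primitive : LinForm → Set
Primitive c = ∀ (d : ℤ) → (∀ i → d ℤD.∣ c i) → ℤ.∣ d ∣ ≡ 1

u₂+u₅ : LinForm
u₂+u₅ zero = + 0
u₂+u₅ (suc zero) = + 0
u₂+u₅ (suc (suc zero)) = + 1
u₂+u₅ (suc (suc (suc zero))) = + 0
u₂+u₅ (suc (suc (suc (suc zero)))) = + 0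
u₂+u₅ (suc (suc (suc (suc (suc zero))))) = + 1

_≡ₗ_mod2 : LinForm → LinForm → Set
c ≡ₗ e mod2 = ∀ i → + 2 ℤD.∣ (c i ℤ.- e i)

-- ℓ-adic integers as coherent sequences:  a : ℕ → ℤ  with
-- a (k+1) ≡ a k (mod ℓ^k); a k represents the residue mod ℓ^k.
-- A vector in ℤ_ℓ^6 is a sequence of integer vectors, coherent coordinatewise.
-- ℤ_ℓ-point of 𝒰_h: primitive vector (some coordinate a unit) on which every
-- defining form vanishes in ℤ_ℓ (≡ 0 mod ℓ^k at every level k) and h(x) ∈ ℤ_ℓ^×.
ZℓPointOfU : (ℓ : ℕ) → LinForm → Set
ZℓPointOfU ℓ h = Σ[ x ∈ (ℕ → Fin 6 → ℤ) ] (
    (∀ k i → + (ℓ ℕ.^ k) ℤD.∣ (x (suc k) i ℤ.- x k i))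
  × (∀ k e → + (ℓ ℕ.^ k) ℤD.∣ evalℤ (equations e) (x k))
  × (Σ[ i ∈ Fin 6 ] ¬ (+ ℓ ℤD.∣ x 1 i))
  × ¬ (+ ℓ ℤD.∣ linℤ h (x 1)))

-- Real numbers as regular Cauchy sequences of rationals (Bishop):
-- q : ℕ → ℚ with |q m - q n| ≤ 1/(m+1) + 1/(n+1).
inv : ℕ → ℚ
inv k = + 1 ℚ./ suc k

IsRegular : (ℕ → ℚ) → Set
IsRegular q = ∀ m k → ℚ.∣ q m ℚ.- q k ∣ ℚ.≤ inv m ℚ.+ inv k

TendsToZero : (ℕ → ℚ) → Set
TendsToZero s = ∀ k → Σ[ N ∈ ℕ ] ∀ m → m ≥ N → ℚ.∣ s m ∣ ℚ.≤ inv k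

AwayFromZero : (ℕ → ℚ) → Set
AwayFromZero s = Σ[ k ∈ ℕ ] Σ[ N ∈ ℕ ] ∀ m → m ≥ N → inv k ℚ.≤ ℚ.∣ s m ∣

-- ℝ-point of 𝒰_h: a point x ∈ ℝ^6 (coordinates regular Cauchy sequences)
-- with all defining forms vanishing and h(x) ≠ 0 (so x ≠ 0 automatically).
RPointOfU : LinForm → Set
RPointOfU h = Σ[ x ∈ (ℕ → Fin 6 → ℚ) ] (
    (∀ i → IsRegular (λ m → x m i))
  × (∀ e → TendsToZero (λ m → evalℚ (equations e) (x m)))
  × AwayFromZero (λ m → linℚ h (x m)))

ELS : LinForm → Set
ELS h = RPointOfU h × (∀ ℓ → Prime ℓ → ZℓPointOfU ℓ h)

-- Necessity is a parity obstruction.  Reducing a vector modulo 2 and checking the 64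
-- vectors of {0,1}⁶ shows that u₂ + u₅ is even at every point of 𝒳 mod 2
-- (parity-constraint).  The first level of a ℤ₂-point of 𝒰_h is such a point at which h
-- is odd, impossible if h ≡ u₂ + u₅ (mod 2).
--
-- Sufficiency uses sixteen integral points of 𝒳.  Their integer span contains the
-- lattice Λ = {x | x₂ ≡ x₅ (mod 2)}, so a prime ℓ dividing h at all of them divides h on
-- Λ (points-span-Λ).  For odd ℓ this makes ℓ divide every coefficient of h; for ℓ = 2 it
-- gives either that or h ≡ u₂ + u₅ (mod 2).  Hence for each prime ℓ some point has
-- ℓ ∤ h(x), and as a constant sequence it is a ℤ_ℓ-point of 𝒰_h; the point found for
-- ℓ = 2 has h(x) ≠ 0, so it is also a real point.

module Submission where

open import Defs
open import Data.Product using (_×_)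
open import Function.Bundles using (_⇔_)
open import Relation.Nullary using (¬_)

open import Agda.Builtin.FromNat using (fromNat)
open import Data.Empty using (⊥-elim)
open import Data.Fin using (Fin; zero; suc; toℕ; fromℕ<; #_)
open import Data.Fin.Properties using (all?; ¬∀⟶∃¬; toℕ-fromℕ<)
open import Data.Integer as ℤ using (ℤ; +_; -[1+_]; 0ℤ; _+_; _-_; _*_)
open import Data.Integer.DivMod using (_%ℕ_; _/ℕ_; n%ℕd<d; a≡a%ℕn+[a/ℕn]*n)
open import Data.Integer.Divisibility.Signed
  using (_∣_; divides; ∣ᵤ⇒∣; ∣⇒∣ᵤ; _∣?_; ∣-refl; ∣m∣n⇒∣m+n; ∣m∣n⇒∣m-n; ∣m+n∣n⇒∣m; ∣m⇒∣-m; ∣n⇒∣m*n; ∣m⇒∣m*n)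
import Data.Integer.Divisibility as ℤD
import Data.Integer.Literals as ℤLiterals
import Data.Integer.Properties as ℤP
open import Data.Integer.Tactic.RingSolver using (solve-∀)
open import Data.List using (List; []; _∷_)
open import Data.Nat as ℕ using (ℕ; suc; s≤s; z≤n)
import Data.Nat.Coprimality as Coprimality
import Data.Nat.Divisibility as ℕD
import Data.Nat.Literals as ℕLiterals
import Data.Nat.Properties as ℕP
open import Data.Nat.Primality using (Prime; prime?; euclidsLemma; prime⇒nonTrivial)
open import Data.Product using (_,_; Σ-syntax)
open import Data.Rational as ℚ using (ℚ; mkℚ)
import Data.Rational.Properties as ℚP
open import Data.Sum using (inj₁; inj₂)
open import Data.Unit using (tt)
open import Data.Vec using (Vec; []; _∷_; lookup)
open import Function.Bundles using (mk⇔)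
open import Relation.Nullary using (yes; no)
open import Relation.Nullary.Decidable using (toWitness; _→-dec_)
open import Relation.Binary.PropositionalEquality

instance
  trivial-constraint = tt
  ℕ-literals = ℕLiterals.number
  ℤ-literals = ℤLiterals.number
  ℤ-negative-literals = ℤLiterals.negative

infix 4 _≡_mod_

-- a ≡ b (mod m): m divides a - b.  Wrapping signed divisibility in a record keeps
-- the three integers visible to type inference.
record _≡_mod_ (a b m : ℤ) : Set where
  constructor congruent
  field divides-difference : m ∣ a - b

∣0 : ∀ m → m ∣ 0ℤ
∣0 m = divides 0ℤ refl

≡-mod-refl : ∀ {m} a → a ≡ a mod m
≡-mod-refl {m} a = congruent (subst (m ∣_) (sym (ℤP.+-inverseʳ a)) (∣0 m))

≡-mod-sym : ∀ {m a b} → a ≡ b mod m → b ≡ a mod m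
≡-mod-sym {m} {a} {b} (congruent m∣a-b) = congruent (subst (m ∣_) (neg-minus a b) (∣m⇒∣-m m∣a-b))
  where
  neg-minus : ∀ a b → ℤ.- (a - b) ≡ b - a
  neg-minus = solve-∀

∣-resp-≡-mod : ∀ {m a b} → a ≡ b mod m → m ∣ a → m ∣ b
∣-resp-≡-mod {m} {a} {b} (congruent m∣a-b) m∣a = subst (m ∣_) (undo a b) (∣m∣n⇒∣m-n m∣a m∣a-b)
  where
  undo : ∀ a b → a - (a - b) ≡ b
  undo = solve-∀

+-cong-mod : ∀ {m a a′ b b′} → a ≡ a′ mod m → b ≡ b′ mod m → a + b ≡ a′ + b′ mod m
+-cong-mod {m} {a} {a′} {b} {b′} (congruent m∣a-a′) (congruent m∣b-b′) =
  congruent (subst (m ∣_) (sym (split a a′ b b′)) (∣m∣n⇒∣m+n m∣a-a′ m∣b-b′))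
  where
  split : ∀ a a′ b b′ → (a + b) - (a′ + b′) ≡ (a - a′) + (b - b′)
  split = solve-∀

*-cong-mod : ∀ {m a a′ b b′} → a ≡ a′ mod m → b ≡ b′ mod m → a * b ≡ a′ * b′ mod m
*-cong-mod {m} {a} {a′} {b} {b′} (congruent m∣a-a′) (congruent m∣b-b′) =
  congruent (subst (m ∣_) (sym (split a a′ b b′)) (∣m∣n⇒∣m+n (∣m⇒∣m*n b m∣a-a′) (∣n⇒∣m*n a′ m∣b-b′)))
  where
  split : ∀ a a′ b b′ → a * b - a′ * b′ ≡ (a - a′) * b + a′ * (b - b′)
  split = solve-∀

evalℤ-cong : ∀ {m} F {x y : Fin 6 → ℤ} → (∀ i → x i ≡ y i mod m) → evalℤ F x ≡ evalℤ F y mod m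
evalℤ-cong [] _ = ≡-mod-refl 0ℤ
evalℤ-cong ((c ·u i u j) ∷ F) x≡y =
  +-cong-mod (*-cong-mod (*-cong-mod (≡-mod-refl c) (x≡y i)) (x≡y j)) (evalℤ-cong F x≡y)

linℤ-cong : ∀ {m} {c c′ x x′ : Fin 6 → ℤ} →
            (∀ i → c i ≡ c′ i mod m) → (∀ i → x i ≡ x′ i mod m) → linℤ c x ≡ linℤ c′ x′ mod m
linℤ-cong {m} {c} {c′} {x} {x′} c≡ x≡ =
  +-cong-mod (+-cong-mod (+-cong-mod (+-cong-mod (+-cong-mod
    (term u₀) (term u₁)) (term u₂)) (term u₃)) (term u₄)) (term u₅)
  where
  term : ∀ i → c i * x i ≡ c′ i * x′ i mod m
  term i = *-cong-mod (c≡ i) (x≡ i)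

linℤ-divisible : ∀ {m} c (x : Fin 6 → ℤ) → (∀ i → m ∣ x i) → m ∣ linℤ c x
linℤ-divisible {m} c x m∣x =
  ∣m∣n⇒∣m+n (∣m∣n⇒∣m+n (∣m∣n⇒∣m+n (∣m∣n⇒∣m+n (∣m∣n⇒∣m+n
    (term u₀) (term u₁)) (term u₂)) (term u₃)) (term u₄)) (term u₅)
  where
  term : ∀ i → m ∣ c i * x i
  term i = ∣n⇒∣m*n (c i) (m∣x i)

parity : ℤ → Fin 2
parity a = fromℕ< (n%ℕd<d a 2)

≡-parity : ∀ a → a ≡ + toℕ (parity a) mod 2
≡-parity a = congruent (divides (a /ℕ 2) (begin
  a - + toℕ (parity a)                    ≡⟨ cong (λ r → a - + r) (toℕ-fromℕ< (n%ℕd<d a 2)) ⟩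
  a - + (a %ℕ 2)                          ≡⟨ cong (_- + (a %ℕ 2)) (a≡a%ℕn+[a/ℕn]*n a 2) ⟩
  + (a %ℕ 2) + (a /ℕ 2) * 2 - + (a %ℕ 2)  ≡⟨ cancel (+ (a %ℕ 2)) (a /ℕ 2) ⟩
  (a /ℕ 2) * 2                            ∎))
  where
  open ≡-Reasoning
  cancel : ∀ r q → r + q * 2 - r ≡ q * 2
  cancel = solve-∀

binary : Fin 2 → Fin 2 → Fin 2 → Fin 2 → Fin 2 → Fin 2 → Fin 6 → ℤ
binary b₀ b₁ b₂ b₃ b₄ b₅ i = + toℕ (lookup (b₀ ∷ b₁ ∷ b₂ ∷ b₃ ∷ b₄ ∷ b₅ ∷ []) i)

EvenOn𝒳 : (Fin 6 → ℤ) → Set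
EvenOn𝒳 x = ∀ e → 2 ∣ evalℤ (equations e) x

binary-parity : ∀ b₀ b₁ b₂ b₃ b₄ b₅ →
  EvenOn𝒳 (binary b₀ b₁ b₂ b₃ b₄ b₅) → 2 ∣ linℤ u₂+u₅ (binary b₀ b₁ b₂ b₃ b₄ b₅)
binary-parity = toWitness {a? = all? λ b₀ → all? λ b₁ → all? λ b₂ → all? λ b₃ → all? λ b₄ → all? λ b₅ →
  let y = binary b₀ b₁ b₂ b₃ b₄ b₅ in
  all? (λ e → 2 ∣? evalℤ (equations e) y) →-dec (2 ∣? linℤ u₂+u₅ y)} tt

-- Every integral point of 𝒳 mod 2 has u₂ + u₅ even: reduce it to a 0/1-vector.
parity-constraint : ∀ x → EvenOn𝒳 x → 2 ∣ linℤ u₂+u₅ x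
parity-constraint x x-even = ∣-resp-≡-mod (≡-mod-sym x≡y-at-u₂+u₅) (binary-parity _ _ _ _ _ _ y-even)
  where
  y : Fin 6 → ℤ
  y = binary (parity (x u₀)) (parity (x u₁)) (parity (x u₂)) (parity (x u₃)) (parity (x u₄)) (parity (x u₅))
  x≡y : ∀ i → x i ≡ y i mod 2
  x≡y zero = ≡-parity (x u₀)
  x≡y (suc zero) = ≡-parity (x u₁)
  x≡y (suc (suc zero)) = ≡-parity (x u₂)
  x≡y (suc (suc (suc zero))) = ≡-parity (x u₃)
  x≡y (suc (suc (suc (suc zero)))) = ≡-parity (x u₄)
  x≡y (suc (suc (suc (suc (suc zero))))) = ≡-parity (x u₅)
  y-even : EvenOn𝒳 y
  y-even e = ∣-resp-≡-mod (evalℤ-cong (equations e) x≡y) (x-even e)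
  x≡y-at-u₂+u₅ : linℤ u₂+u₅ x ≡ linℤ u₂+u₅ y mod 2
  x≡y-at-u₂+u₅ = linℤ-cong (λ i → ≡-mod-refl (u₂+u₅ i)) x≡y

prime-2 : Prime 2
prime-2 = toWitness {a? = prime? 2} tt

-- Necessity: a ℤ₂-point of 𝒰_h reduces to a point of 𝒳 mod 2 where h is odd, while
-- h ≡ u₂ + u₅ (mod 2) would make h even there.
ELS⇒incongruent : ∀ h → ELS h → ¬ (h ≡ₗ u₂+u₅ mod2)
ELS⇒incongruent h (_ , ℤℓ-points) h≡u₂+u₅ with ℤℓ-points 2 prime-2
... | x , _ , on𝒳 , _ , 2∤hx = 2∤hx (∣⇒∣ᵤ (∣-resp-≡-mod (≡-mod-sym hx≡) (parity-constraint (x 1) x-even)))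
  where
  x-even : EvenOn𝒳 (x 1)
  x-even e = ∣ᵤ⇒∣ (on𝒳 1 e)
  hx≡ : linℤ h (x 1) ≡ linℤ u₂+u₅ (x 1) mod 2
  hx≡ = linℤ-cong {c = h} {c′ = u₂+u₅} (λ i → congruent (∣ᵤ⇒∣ (h≡u₂+u₅ i))) (λ i → ≡-mod-refl (x 1 i))

On𝒳 : (Fin 6 → ℤ) → Set
On𝒳 x = ∀ e → evalℤ (equations e) x ≡ 0ℤ

pointTable : Vec (Vec ℤ 6) 16
pointTable =
    (1 ∷ 0 ∷ 0 ∷ 0 ∷ 0 ∷ 0 ∷ [])
  ∷ (243 ∷ 58 ∷ 7 ∷ -2 ∷ -1 ∷ -1 ∷ [])
  ∷ (265 ∷ 50 ∷ 23 ∷ -8 ∷ -5 ∷ -3 ∷ [])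
  ∷ (397 ∷ 8 ∷ -1 ∷ 20 ∷ 3 ∷ 7 ∷ [])
  ∷ (615 ∷ 114 ∷ 23 ∷ -5 ∷ -4 ∷ -3 ∷ [])
  ∷ (693 ∷ 88 ∷ 11 ∷ 0 ∷ -1 ∷ -1 ∷ [])
  ∷ (693 ∷ 110 ∷ 11 ∷ 0 ∷ -1 ∷ -3 ∷ [])
  ∷ (551 ∷ 178 ∷ 4 ∷ 92 ∷ 8 ∷ 24 ∷ [])
  ∷ (813 ∷ 232 ∷ 26 ∷ -12 ∷ -4 ∷ -4 ∷ [])
  ∷ (1189 ∷ 68 ∷ 2 ∷ 4 ∷ 4 ∷ 12 ∷ [])
  ∷ (1475 ∷ 3 ∷ -16 ∷ 9 ∷ 7 ∷ 8 ∷ [])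
  ∷ (1539 ∷ 26 ∷ 17 ∷ 17 ∷ -2 ∷ -5 ∷ [])
  ∷ (1539 ∷ 69 ∷ 2 ∷ 13 ∷ 5 ∷ 12 ∷ [])
  ∷ (1419 ∷ 253 ∷ 22 ∷ -11 ∷ -1 ∷ 2 ∷ [])
  ∷ (1563 ∷ 155 ∷ 12 ∷ 1 ∷ 1 ∷ 2 ∷ [])
  ∷ (1540 ∷ 231 ∷ 22 ∷ 0 ∷ -1 ∷ -2 ∷ [])
  ∷ []

point : Fin 16 → Fin 6 → ℤ
point k = lookup (lookup pointTable k)

points-on-𝒳 : ∀ k → On𝒳 (point k)
points-on-𝒳 = toWitness {a? = all? λ k → all? λ e → evalℤ (equations e) (point k) ℤ.≟ 0ℤ} tt

Combination : Set
Combination = List (ℤ × Fin 16)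

combination : Combination → Fin 6 → ℤ
combination [] i = 0ℤ
combination ((a , k) ∷ L) i = a * point k i + combination L i

linℤ-zero : ∀ h → linℤ h (λ _ → 0ℤ) ≡ 0ℤ
linℤ-zero h = identity (h u₀) (h u₁) (h u₂) (h u₃) (h u₄) (h u₅)
  where
  identity : ∀ c₀ c₁ c₂ c₃ c₄ c₅ → c₀ * 0 + c₁ * 0 + c₂ * 0 + c₃ * 0 + c₄ * 0 + c₅ * 0 ≡ 0
  identity = solve-∀

linℤ-step : ∀ h a (p q : Fin 6 → ℤ) → linℤ h (λ i → a * p i + q i) ≡ a * linℤ h p + linℤ h q
linℤ-step h a p q =
  identity (h u₀) (h u₁) (h u₂) (h u₃) (h u₄) (h u₅) a
           (p u₀) (p u₁) (p u₂) (p u₃) (p u₄) (p u₅) (q u₀) (q u₁) (q u₂) (q u₃) (q u₄) (q u₅)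
  where
  identity : ∀ c₀ c₁ c₂ c₃ c₄ c₅ a p₀ p₁ p₂ p₃ p₄ p₅ q₀ q₁ q₂ q₃ q₄ q₅ →
    c₀ * (a * p₀ + q₀) + c₁ * (a * p₁ + q₁) + c₂ * (a * p₂ + q₂)
      + c₃ * (a * p₃ + q₃) + c₄ * (a * p₄ + q₄) + c₅ * (a * p₅ + q₅)
    ≡ a * (c₀ * p₀ + c₁ * p₁ + c₂ * p₂ + c₃ * p₃ + c₄ * p₄ + c₅ * p₅)
      + (c₀ * q₀ + c₁ * q₁ + c₂ * q₂ + c₃ * q₃ + c₄ * q₄ + c₅ * q₅)
  identity = solve-∀

combination-divisible : ∀ {d} h → (∀ k → d ∣ linℤ h (point k)) → ∀ L → d ∣ linℤ h (combination L)
combination-divisible {d} h d∣h[pt] [] = subst (d ∣_) (sym (linℤ-zero h)) (∣0 d)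
combination-divisible {d} h d∣h[pt] ((a , k) ∷ L) =
  subst (d ∣_) (sym (linℤ-step h a (point k) (combination L)))
    (∣m∣n⇒∣m+n (∣n⇒∣m*n a (d∣h[pt] k)) (combination-divisible h d∣h[pt] L))

-- d divides the values of h on Λ, recorded on the basis e₀, e₁, e₃, e₄, e₂ + e₅, 2e₅ of Λ.
record DividesOnΛ (d : ℤ) (h : LinForm) : Set where
  field
    at-e₀ : d ∣ h u₀
    at-e₁ : d ∣ h u₁
    at-e₃ : d ∣ h u₃
    at-e₄ : d ∣ h u₄
    at-e₂+e₅ : d ∣ h u₂ + h u₅
    at-2e₅ : d ∣ 2 * h u₅

-- Each basis vector of Λ is an explicit integer combination of the sixteen points
-- (the combinations evaluate to e₀, e₁, e₃, e₄, e₂ + e₅, 2e₅ by computation).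
points-span-Λ : ∀ {d} h → (∀ k → d ∣ linℤ h (point k)) → DividesOnΛ d h
points-span-Λ {d} h d∣h[pt] = record
  { at-e₀ = subst (d ∣_) (value-e₀ (h u₀) (h u₁) (h u₂) (h u₃) (h u₄) (h u₅)) (on-span e₀)
  ; at-e₁ = subst (d ∣_) (value-e₁ (h u₀) (h u₁) (h u₂) (h u₃) (h u₄) (h u₅)) (on-span e₁)
  ; at-e₃ = subst (d ∣_) (value-e₃ (h u₀) (h u₁) (h u₂) (h u₃) (h u₄) (h u₅)) (on-span e₃)
  ; at-e₄ = subst (d ∣_) (value-e₄ (h u₀) (h u₁) (h u₂) (h u₃) (h u₄) (h u₅)) (on-span e₄)
  ; at-e₂+e₅ = subst (d ∣_) (value-e₂+e₅ (h u₀) (h u₁) (h u₂) (h u₃) (h u₄) (h u₅)) (on-span e₂+e₅)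
  ; at-2e₅ = subst (d ∣_) (value-2e₅ (h u₀) (h u₁) (h u₂) (h u₃) (h u₄) (h u₅)) (on-span 2e₅)
  }
  where
  on-span : ∀ L → d ∣ linℤ h (combination L)
  on-span = combination-divisible h d∣h[pt]
  e₀ e₁ e₃ e₄ e₂+e₅ 2e₅ : Combination
  e₀ = (1 , # 0) ∷ []
  e₁ = (29642696774354948 , # 0) ∷ (-877420659994340 , # 1) ∷ (1356391926736 , # 4)
     ∷ (98823736164009 , # 6) ∷ (1478786342694 , # 7) ∷ (27158697754481 , # 8)
     ∷ (-148959800788780 , # 10) ∷ (-42170941700593 , # 11) ∷ (-21733097917020 , # 13)
     ∷ (260276808092805 , # 14) ∷ (39736566 , # 15) ∷ []
  e₃ = (-155909537004 , # 0) ∷ (4614905652 , # 1) ∷ (-7134116 , # 4) ∷ (-519776020 , # 6)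
     ∷ (-7777865 , # 7) ∷ (-142844628 , # 8) ∷ (783473034 , # 10) ∷ (221803436 , # 11)
     ∷ (114307995 , # 13) ∷ (-1368959004 , # 14) ∷ (-209 , # 15) ∷ []
  e₄ = (-748109501 , # 0) ∷ (22143939 , # 1) ∷ (-34232 , # 4) ∷ (-2494068 , # 6)
     ∷ (-37321 , # 7) ∷ (-685419 , # 8) ∷ (3759379 , # 10) ∷ (1064291 , # 11)
     ∷ (548490 , # 13) ∷ (-6568746 , # 14) ∷ (-1 , # 15) ∷ []
  e₂+e₅ = (-95401186970352 , # 0) ∷ (2823864949701 , # 1) ∷ (-4365372044 , # 4)
        ∷ (-318051417611 , # 6) ∷ (-4759282647 , # 7) ∷ (-87406757289 , # 8)
        ∷ (479407859355 , # 10) ∷ (135721723449 , # 11) ∷ (69945165705 , # 13)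
        ∷ (-837667254835 , # 14) ∷ (-127887 , # 15) ∷ []
  2e₅ = (961735 , # 0) ∷ (-28461 , # 1) ∷ (44 , # 4) ∷ (3205 , # 6) ∷ (48 , # 7)
      ∷ (881 , # 8) ∷ (-4832 , # 10) ∷ (-1368 , # 11) ∷ (-705 , # 13) ∷ (8443 , # 14) ∷ []
  value-e₀ : ∀ c₀ c₁ c₂ c₃ c₄ c₅ → c₀ * 1 + c₁ * 0 + c₂ * 0 + c₃ * 0 + c₄ * 0 + c₅ * 0 ≡ c₀
  value-e₀ = solve-∀
  value-e₁ : ∀ c₀ c₁ c₂ c₃ c₄ c₅ → c₀ * 0 + c₁ * 1 + c₂ * 0 + c₃ * 0 + c₄ * 0 + c₅ * 0 ≡ c₁
  value-e₁ = solve-∀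
  value-e₃ : ∀ c₀ c₁ c₂ c₃ c₄ c₅ → c₀ * 0 + c₁ * 0 + c₂ * 0 + c₃ * 1 + c₄ * 0 + c₅ * 0 ≡ c₃
  value-e₃ = solve-∀
  value-e₄ : ∀ c₀ c₁ c₂ c₃ c₄ c₅ → c₀ * 0 + c₁ * 0 + c₂ * 0 + c₃ * 0 + c₄ * 1 + c₅ * 0 ≡ c₄
  value-e₄ = solve-∀
  value-e₂+e₅ : ∀ c₀ c₁ c₂ c₃ c₄ c₅ → c₀ * 0 + c₁ * 0 + c₂ * 1 + c₃ * 0 + c₄ * 0 + c₅ * 1 ≡ c₂ + c₅
  value-e₂+e₅ = solve-∀
  value-2e₅ : ∀ c₀ c₁ c₂ c₃ c₄ c₅ → c₀ * 0 + c₁ * 0 + c₂ * 0 + c₃ * 0 + c₄ * 0 + c₅ * 2 ≡ 2 * c₅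
  value-2e₅ = solve-∀

primitive⇒no-common-divisor : ∀ {h ℓ} → Primitive h → 1 ℕ.< ℓ → ¬ (∀ i → + ℓ ∣ h i)
primitive⇒no-common-divisor {ℓ = ℓ} prim 1<ℓ ℓ∣h = ℕP.<⇒≢ 1<ℓ (sym (prim (+ ℓ) (λ i → ∣⇒∣ᵤ (ℓ∣h i))))

DividesOnΛ⇒all : ∀ {d h} → DividesOnΛ d h → d ∣ h u₅ → ∀ i → d ∣ h i
DividesOnΛ⇒all onΛ d∣h₅ zero = DividesOnΛ.at-e₀ onΛ
DividesOnΛ⇒all onΛ d∣h₅ (suc zero) = DividesOnΛ.at-e₁ onΛ
DividesOnΛ⇒all onΛ d∣h₅ (suc (suc zero)) = ∣m+n∣n⇒∣m (DividesOnΛ.at-e₂+e₅ onΛ) d∣h₅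
DividesOnΛ⇒all onΛ d∣h₅ (suc (suc (suc zero))) = DividesOnΛ.at-e₃ onΛ
DividesOnΛ⇒all onΛ d∣h₅ (suc (suc (suc (suc zero)))) = DividesOnΛ.at-e₄ onΛ
DividesOnΛ⇒all onΛ d∣h₅ (suc (suc (suc (suc (suc zero))))) = d∣h₅

-- An odd prime dividing h on Λ divides h(2e₅), hence h(e₅), hence all coefficients.
odd-prime-case : ∀ {h ℓ} → Primitive h → Prime ℓ → ℓ ≢ 2 → ¬ DividesOnΛ (+ ℓ) h
odd-prime-case {h} {ℓ} prim ℓ-prime ℓ≢2 onΛ =
  primitive⇒no-common-divisor prim 1<ℓ (DividesOnΛ⇒all onΛ ℓ∣h₅)
  where
  1<ℓ : 1 ℕ.< ℓ
  1<ℓ = ℕ.nonTrivial⇒n>1 ℓ {{prime⇒nonTrivial ℓ-prime}}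
  ℓ∣2h₅ : ℓ ℕD.∣ 2 ℕ.* ℤ.∣ h u₅ ∣
  ℓ∣2h₅ = subst (ℓ ℕD.∣_) (ℤP.abs-* 2 (h u₅)) (∣⇒∣ᵤ (DividesOnΛ.at-2e₅ onΛ))
  ℓ∣h₅ : + ℓ ∣ h u₅
  ℓ∣h₅ with euclidsLemma 2 ℤ.∣ h u₅ ∣ ℓ-prime ℓ∣2h₅
  ... | inj₁ ℓ∣2 = ⊥-elim (ℓ≢2 (ℕP.≤-antisym (ℕD.∣⇒≤ ℓ∣2) 1<ℓ))
  ... | inj₂ ℓ∣∣h₅∣ = ∣ᵤ⇒∣ ℓ∣∣h₅∣

-- For ℓ = 2: if h(e₅) is even then all coefficients are, and if it is odd then the
-- conditions on Λ say exactly that h ≡ u₂ + u₅ (mod 2).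
two-case : ∀ {h} → Primitive h → ¬ (h ≡ₗ u₂+u₅ mod2) → ¬ DividesOnΛ 2 h
two-case {h} prim h≢u₂+u₅ onΛ with parity (h u₅) | ≡-parity (h u₅)
... | zero | congruent 2∣h₅-0 =
  primitive⇒no-common-divisor prim (s≤s (s≤s z≤n))
    (DividesOnΛ⇒all onΛ (subst (2 ∣_) (ℤP.+-identityʳ (h u₅)) 2∣h₅-0))
... | suc zero | congruent 2∣h₅-1 = h≢u₂+u₅ h≡u₂+u₅
  where
  open DividesOnΛ onΛ
  even⇒≡0 : ∀ {a} → 2 ∣ a → + 2 ℤD.∣ a - 0ℤ
  even⇒≡0 {a} 2∣a = ∣⇒∣ᵤ (subst (2 ∣_) (sym (ℤP.+-identityʳ a)) 2∣a)
  rearrange : ∀ a b → a + b - (b - 1) - 2 ≡ a - 1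
  rearrange = solve-∀
  h≡u₂+u₅ : h ≡ₗ u₂+u₅ mod2
  h≡u₂+u₅ zero = even⇒≡0 at-e₀
  h≡u₂+u₅ (suc zero) = even⇒≡0 at-e₁
  h≡u₂+u₅ (suc (suc zero)) =
    ∣⇒∣ᵤ (subst (2 ∣_) (rearrange (h u₂) (h u₅)) (∣m∣n⇒∣m-n (∣m∣n⇒∣m-n at-e₂+e₅ 2∣h₅-1) ∣-refl))
  h≡u₂+u₅ (suc (suc (suc zero))) = even⇒≡0 at-e₃
  h≡u₂+u₅ (suc (suc (suc (suc zero)))) = even⇒≡0 at-e₄
  h≡u₂+u₅ (suc (suc (suc (suc (suc zero))))) = ∣⇒∣ᵤ 2∣h₅-1

-- For every prime ℓ some point has h-value prime to ℓ: otherwise ℓ would divide h on Λ.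
point-prime-to : ∀ h {ℓ} → Primitive h → ¬ (h ≡ₗ u₂+u₅ mod2) → Prime ℓ →
                 Σ[ k ∈ Fin 16 ] ¬ (+ ℓ ℤD.∣ linℤ h (point k))
point-prime-to h {ℓ} prim h≢u₂+u₅ ℓ-prime =
  ¬∀⟶∃¬ 16 _ (λ k → ℓ ℕD.∣? ℤ.∣ linℤ h (point k) ∣) not-all-divisible
  where
  not-all-divisible : ¬ (∀ k → + ℓ ℤD.∣ linℤ h (point k))
  not-all-divisible ℓ∣h[pt] with points-span-Λ h (λ k → ∣ᵤ⇒∣ (ℓ∣h[pt] k)) | ℓ ℕ.≟ 2
  ... | onΛ | yes refl = two-case prim h≢u₂+u₅ onΛ
  ... | onΛ | no ℓ≢2 = odd-prime-case prim ℓ-prime ℓ≢2 onΛ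

-- An integral point of 𝒳 with ℓ ∤ h(x) is, as a constant sequence, a ℤ_ℓ-point of 𝒰_h;
-- some coordinate is an ℓ-adic unit because otherwise ℓ would divide h(x).
integral⇒ZℓPoint : ∀ {ℓ} h x → On𝒳 x → ¬ (+ ℓ ℤD.∣ linℤ h x) → ZℓPointOfU ℓ h
integral⇒ZℓPoint {ℓ} h x x-on𝒳 ℓ∤hx = (λ _ → x) , coherent , on𝒳 , unit-coordinate , ℓ∤hx
  where
  coherent : ∀ k i → + (ℓ ℕ.^ k) ℤD.∣ x i - x i
  coherent k i = ∣⇒∣ᵤ (subst (+ (ℓ ℕ.^ k) ∣_) (sym (ℤP.+-inverseʳ (x i))) (∣0 _))
  on𝒳 : ∀ k e → + (ℓ ℕ.^ k) ℤD.∣ evalℤ (equations e) x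
  on𝒳 k e = ∣⇒∣ᵤ (subst (+ (ℓ ℕ.^ k) ∣_) (sym (x-on𝒳 e)) (∣0 _))
  unit-coordinate : Σ[ i ∈ Fin 6 ] ¬ (+ ℓ ℤD.∣ x i)
  unit-coordinate = ¬∀⟶∃¬ 6 _ (λ i → ℓ ℕD.∣? ℤ.∣ x i ∣)
    (λ ℓ∣x → ℓ∤hx (∣⇒∣ᵤ (linℤ-divisible {+ ℓ} h x (λ i → ∣ᵤ⇒∣ (ℓ∣x i)))))

-- The embedding of ℤ into ℚ (the forms over ℚ use exactly these constants).
ι : ℤ → ℚ
ι a = a ℚ./ 1

coprime-to-1 : ∀ n → Coprimality.Coprime n 1
coprime-to-1 n = Coprimality.sym (Coprimality.1-coprimeTo n)

-- The fraction a/1 in lowest terms; unlike ι, its numerator can be read off by unification.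
_/1 : ℤ → ℚ
a /1 = mkℚ a 0 (coprime-to-1 ℤ.∣ a ∣)

ι-canonical : ∀ a → ι a ≡ a /1
ι-canonical (+ n) = ℚP.normalize-coprime (coprime-to-1 n)
ι-canonical -[1+ n ] = cong ℚ.-_ (ℚP.normalize-coprime (coprime-to-1 (suc n)))

ι-+ : ∀ a b → ι a ℚ.+ ι b ≡ ι (a + b)
ι-+ a b rewrite ι-canonical a | ι-canonical b | ℤP.*-identityʳ a | ℤP.*-identityʳ b = refl

ι-* : ∀ a b → ι a ℚ.* ι b ≡ ι (a * b)
ι-* a b rewrite ι-canonical a | ι-canonical b = refl

evalℚ-ι : ∀ F (x : Fin 6 → ℤ) → evalℚ F (λ i → ι (x i)) ≡ ι (evalℤ F x)
evalℚ-ι [] x = refl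
evalℚ-ι ((c ·u i u j) ∷ F) x = begin
  ι c ℚ.* ι (x i) ℚ.* ι (x j) ℚ.+ evalℚ F (λ i → ι (x i))
    ≡⟨ cong₂ ℚ._+_ (trans (cong (ℚ._* ι (x j)) (ι-* c (x i))) (ι-* (c * x i) (x j))) (evalℚ-ι F x) ⟩
  ι (c * x i * x j) ℚ.+ ι (evalℤ F x)
    ≡⟨ ι-+ (c * x i * x j) (evalℤ F x) ⟩
  ι (c * x i * x j + evalℤ F x) ∎
  where open ≡-Reasoning

-- Likewise for a linear form; the partial sums are tracked as fractions s/1.
linℚ-ι : ∀ h (x : Fin 6 → ℤ) → linℚ h (λ i → ι (x i)) ≡ ι (linℤ h x)
linℚ-ι h x = trans
  (extend u₅ (extend u₄ (extend u₃ (extend u₂ (extend u₁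
    (trans (ι-* (h u₀) (x u₀)) (ι-canonical (h u₀ * x u₀))))))))
  (sym (ι-canonical (linℤ h x)))
  where
  extend : ∀ i {q s} → q ≡ s /1 → q ℚ.+ ι (h i) ℚ.* ι (x i) ≡ (s + h i * x i) /1
  extend i {q} {s} q≡s = begin
    q ℚ.+ ι (h i) ℚ.* ι (x i)  ≡⟨ cong₂ ℚ._+_ (trans q≡s (sym (ι-canonical s))) (ι-* (h i) (x i)) ⟩
    ι s ℚ.+ ι (h i * x i)       ≡⟨ ι-+ s (h i * x i) ⟩
    ι (s + h i * x i)           ≡⟨ ι-canonical (s + h i * x i) ⟩
    (s + h i * x i) /1          ∎
    where open ≡-Reasoning

0≤inv : ∀ k → ℚ.0ℚ ℚ.≤ inv k
0≤inv k = ℚP.nonNegative⁻¹ (inv k) {{ℚP.normalize-nonNeg 1 (suc k)}}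

1≤∣ι∣ : ∀ z → z ≢ 0ℤ → inv 0 ℚ.≤ ℚ.∣ ι z ∣
1≤∣ι∣ z z≢0 rewrite ι-canonical z with ℤ.∣ z ∣ in ∣z∣≡
... | 0 = ⊥-elim (z≢0 (ℤP.∣i∣≡0⇒i≡0 ∣z∣≡))
... | suc _ = ℚ.*≤* (ℤ.+≤+ (s≤s z≤n))

integral⇒RPoint : ∀ h x → On𝒳 x → linℤ h x ≢ 0ℤ → RPointOfU h
integral⇒RPoint h x x-on𝒳 hx≢0 = (λ _ i → ι (x i)) , regular , vanishing , away-from-zero
  where
  regular : ∀ i → IsRegular (λ _ → ι (x i))
  regular i m k = subst (ℚ._≤ inv m ℚ.+ inv k) (sym (cong ℚ.∣_∣ (ℚP.+-inverseʳ (ι (x i)))))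
                        (ℚP.+-mono-≤ (0≤inv m) (0≤inv k))
  vanishing : ∀ e → TendsToZero (λ _ → evalℚ (equations e) (λ i → ι (x i)))
  vanishing e k = 0 , λ _ _ →
    subst (ℚ._≤ inv k) (sym (cong ℚ.∣_∣ (trans (evalℚ-ι (equations e) x) (cong ι (x-on𝒳 e))))) (0≤inv k)
  away-from-zero : AwayFromZero (λ _ → linℚ h (λ i → ι (x i)))
  away-from-zero = 0 , 0 , λ _ _ →
    subst (λ q → inv 0 ℚ.≤ ℚ.∣ q ∣) (sym (linℚ-ι h x)) (1≤∣ι∣ (linℤ h x) hx≢0)

lemma4p2 : (h : LinForm) → Primitive h → (ELS h ⇔ (¬ (h ≡ₗ u₂+u₅ mod2)))
lemma4p2 h prim = mk⇔ (ELS⇒incongruent h) incongruent⇒ELS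
  where
  incongruent⇒ELS : ¬ (h ≡ₗ u₂+u₅ mod2) → ELS h
  incongruent⇒ELS h≢u₂+u₅ = real-point , ℓ-adic-point
    where
    real-point : RPointOfU h
    real-point with point-prime-to h prim h≢u₂+u₅ prime-2
    ... | k , 2∤hk = integral⇒RPoint h (point k) (points-on-𝒳 k)
                       (λ hk≡0 → 2∤hk (subst (+ 2 ℤD.∣_) (sym hk≡0) (2 ℕD.∣0)))
    ℓ-adic-point : ∀ ℓ → Prime ℓ → ZℓPointOfU ℓ h
    ℓ-adic-point ℓ ℓ-prime with point-prime-to h prim h≢u₂+u₅ ℓ-prime
    ... | k , ℓ∤hk = integral⇒ZℓPoint h (point k) (points-on-𝒳 k) ℓ∤hk
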